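{- For $p\in\mathbb{N}_0$ and all $n\in\mathbb{N}$, $$\sum_{m=1}^nm^pH_{m-1}^2=C^{(p)}(n)H_n^2-\big(2C^{(p)}_0(n)+B_p\big)H_n+2C^{(p)}_{0,0}(n)-C^{(p)}_1(n).$$
   Context: $H_m=\sum_{j=1}^m1/j$ is the $m$-th harmonic number ($H_0=0$). Bernoulli numbers: $\frac{te^t}{e^t-1}=\sum_{j\ge0}B_j\frac{t^j}{j!}$ (so $B_1=1/2$). For $p\in\mathbb{N}_0$, $r\ge1$, $a_2,\dots,a_r\in\mathbb{N}_0$ and $a_1=0$, $$C^{(p)}_{a_2,\dots,a_r}(x)=\sum_{\substack{j_1,\dots,j_r\ge0\\ j_1+\dots+j_r\le p-a_r}}\Big(\prod_{i=1}^r\frac{\binom{p+1-a_i-j_1-\dots-j_{i-1}}{j_i}B_{j_i}}{p+1-a_i-j_1-\dots-j_{i-1}}\Big)x^{p+1-a_r-j_1-\dots-j_r}$$ (empty sum $=0$). For $r=1$ (no subscript), $C^{(p)}(x)=\sum_{j=0}^p\binom{p+1}{j}\frac{B_j}{p+1}x^{p+1-j}$, so $C^{(p)}(n)=\sum_{m=1}^nm^p$. -}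

module Defs where

open import Data.Nat as ℕ using (ℕ; zero; suc; _∸_)
open import Data.Nat.Combinatorics using (_C_)
open import Data.Integer using (+_)
open import Data.Rational using (ℚ; 0ℚ; 1ℚ; _+_; _*_; _/_; _-_)
open import Data.List using (List; []; _∷_)
open import Data.Bool using (true; false)

Σ≤ : ℕ → (ℕ → ℚ) → ℚ
Σ≤ zero f = f 0
Σ≤ (suc k) f = Σ≤ k f + f (suc k)

Σ< : ℕ → (ℕ → ℚ) → ℚ
Σ< zero f = 0ℚ
Σ< (suc k) f = Σ< k f + f k

ι : ℕ → ℚ
ι n = (+ n) / 1

-- 1/n for n ≥ 1 (only ever applied with n ≥ 1 in the theorem; 1/0 := 0)
inv : ℕ → ℚ
inv zero = 0ℚ
inv (suc n) = (+ 1) / suc n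

pow : ℚ → ℕ → ℚ
pow x zero = 1ℚ
pow x (suc k) = pow x k * x

-- Bernoulli numbers with B₁ = +1/2 (te^t/(e^t-1)), via
--   Σ_{j=0}^{m} C(m+1,j) B_j = m+1 ,  i.e.
--   B_m = 1 - (1/(m+1)) Σ_{j<m} C(m+1,j) B_j
B : ℕ → ℚ
B m = go m m
  where
  -- go fuel m, fuel ≥ m ensures termination
  go : ℕ → ℕ → ℚ
  go zero _ = 1ℚ
  go (suc fuel) m =
    1ℚ - inv (suc m) * Σ< m (λ j → ι (suc m C j) * go fuel j)

H : ℕ → ℚ
H zero = 0ℚ
H (suc m) = H m + inv (suc m)

-- C^{(p)}_{a₂,…,a_r}(x), with the full list (a₁,…,a_r) = 0 ∷ as.
-- Inner recursion: remaining list of a_i's, J = j₁+…+j_{i-1}, last = a_r.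
-- Each j_i ranges over 0 … (p - a_r) - J, which together enforces
-- j₁+…+j_r ≤ p - a_r (all j ≥ 0).
private
  lastOr : ℕ → List ℕ → ℕ
  lastOr d [] = d
  lastOr d (a ∷ as) = lastOr a as

  CC : ℕ → ℕ → ℚ → List ℕ → ℕ → ℚ
  CC p ar x [] J = pow x (suc p ∸ ar ∸ J)
  CC p ar x (a ∷ as) J =
    Σ≤ (p ∸ ar ∸ J) (λ j →
      let N = suc p ∸ a ∸ J in
      ι (N C j) * B j * inv N * CC p ar x as (J ℕ.+ j))

Cp : ℕ → List ℕ → ℚ → ℚ
Cp p as x with lastOr 0 as
... | ar with ar ℕ.≤ᵇ p
...   | true  = CC p ar x (0 ∷ as) 0
...   | false = 0ℚ

-- Write s, t, u, v for C^(p), C^(p)_0, C^(p)_{0,0}, C^(p)_1 at n.  The recurrence of the Bernoulli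
-- numbers and the binomial theorem give Faulhaber's s(n+1) = s(n) + (n+1)^p.  As t, u, v are
-- combinations of the C^(p-j) and C^(p-j)_0 with the coefficients C(N,j) B_j / N, this propagates to
--   t(n+1) = t(n) + s(n+1)/(n+1),   u(n+1) = u(n) + t(n+1)/(n+1),
--   v(n+1) = v(n) + s(n+1)/(n+1)² − B_p/(n+1),
-- where s(n+1) is divided by n+1 (resp. by (n+1)² after removing its linear term B_p (n+1)).
-- With H_{n+1} = H_n + 1/(n+1), a ring identity shows that the right-hand side then grows by
-- exactly (n+1)^p H_n², and both sides vanish at n = 0.

{-# OPTIONS --safe #-}
module Submission where

open import Defs
open import Data.Nat using (ℕ; suc; _≤_)
open import Data.List using ([]; _∷_)
open import Data.Rational using (ℚ; _+_; _*_; _-_)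
open import Relation.Binary.PropositionalEquality using (_≡_)

open import Data.Nat as ℕ using (zero; _∸_; _<_; _!; z≤n)
import Data.Nat.Properties as ℕ
import Data.Nat.Combinatorics as ℕ
open import Data.Nat.Combinatorics using (_C_)
import Data.Nat.DivMod as ℕ
open import Data.Nat.Tactic.RingSolver using (solve-∀)
import Data.Integer as ℤ
import Data.Integer.Properties as ℤ
open import Data.Rational using (0ℚ; 1ℚ; toℚᵘ)
import Data.Rational.Properties as ℚ
import Data.Rational.Unnormalised as ℚᵘ
import Data.Rational.Unnormalised.Properties as ℚᵘ
open import Data.Product using (Σ; _×_; _,_; proj₁; proj₂)
open import Relation.Binary.PropositionalEquality
  using (refl; sym; trans; cong; cong₂; subst; module ≡-Reasoning)
open import Data.Rational.Solver using (module +-*-Solver)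
open +-*-Solver using (solve; _:+_; _:*_; _:-_; _:=_; con)

toℚᵘ-ι : ∀ n → toℚᵘ (ι n) ℚᵘ.≃ ℚᵘ.mkℚᵘ (ℤ.+ n) 0
toℚᵘ-ι n = ℚ.toℚᵘ-fromℚᵘ (ℚᵘ.mkℚᵘ (ℤ.+ n) 0)

ι-homo-+ : ∀ m n → ι (m ℕ.+ n) ≡ ι m + ι n
ι-homo-+ m n = ℚ.toℚᵘ-injective (begin
    toℚᵘ (ι (m ℕ.+ n))
  ≈⟨ toℚᵘ-ι (m ℕ.+ n) ⟩
    ℚᵘ.mkℚᵘ (ℤ.+ (m ℕ.+ n)) 0
  ≈⟨ ℚᵘ.*≡* (cong (ℤ._* ℤ.+ 1) (trans (sym (ℤ.pos-+ m n))
       (sym (cong₂ ℤ._+_ (ℤ.*-identityʳ (ℤ.+ m)) (ℤ.*-identityʳ (ℤ.+ n)))))) ⟩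
    ℚᵘ.mkℚᵘ (ℤ.+ m) 0 ℚᵘ.+ ℚᵘ.mkℚᵘ (ℤ.+ n) 0
  ≈⟨ ℚᵘ.≃-sym (ℚᵘ.+-cong (toℚᵘ-ι m) (toℚᵘ-ι n)) ⟩
    toℚᵘ (ι m) ℚᵘ.+ toℚᵘ (ι n)
  ≈⟨ ℚᵘ.≃-sym (ℚ.toℚᵘ-homo-+ (ι m) (ι n)) ⟩
    toℚᵘ (ι m + ι n) ∎)
  where open ℚᵘ.≃-Reasoning

ι-homo-* : ∀ m n → ι (m ℕ.* n) ≡ ι m * ι n
ι-homo-* m n = ℚ.toℚᵘ-injective (begin
    toℚᵘ (ι (m ℕ.* n))
  ≈⟨ toℚᵘ-ι (m ℕ.* n) ⟩
    ℚᵘ.mkℚᵘ (ℤ.+ (m ℕ.* n)) 0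
  ≈⟨ ℚᵘ.*≡* (cong (ℤ._* ℤ.+ 1) (ℤ.pos-* m n)) ⟩
    ℚᵘ.mkℚᵘ (ℤ.+ m) 0 ℚᵘ.* ℚᵘ.mkℚᵘ (ℤ.+ n) 0
  ≈⟨ ℚᵘ.≃-sym (ℚᵘ.*-cong (toℚᵘ-ι m) (toℚᵘ-ι n)) ⟩
    toℚᵘ (ι m) ℚᵘ.* toℚᵘ (ι n)
  ≈⟨ ℚᵘ.≃-sym (ℚ.toℚᵘ-homo-* (ι m) (ι n)) ⟩
    toℚᵘ (ι m * ι n) ∎)
  where open ℚᵘ.≃-Reasoning

ι-suc : ∀ n → ι (suc n) ≡ ι n + 1ℚ
ι-suc n = trans (cong ι (ℕ.+-comm 1 n)) (ι-homo-+ n 1)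

ι*inv≡1 : ∀ n → ι (suc n) * inv (suc n) ≡ 1ℚ
ι*inv≡1 n = ℚ.toℚᵘ-injective (begin
    toℚᵘ (ι (suc n) * inv (suc n))
  ≈⟨ ℚ.toℚᵘ-homo-* (ι (suc n)) (inv (suc n)) ⟩
    toℚᵘ (ι (suc n)) ℚᵘ.* toℚᵘ (inv (suc n))
  ≈⟨ ℚᵘ.*-cong (toℚᵘ-ι (suc n)) (ℚ.toℚᵘ-fromℚᵘ (ℚᵘ.mkℚᵘ (ℤ.+ 1) n)) ⟩
    ℚᵘ.mkℚᵘ (ℤ.+ suc n) 0 ℚᵘ.* ℚᵘ.mkℚᵘ (ℤ.+ 1) n
  ≈⟨ ℚᵘ.*≡* (cong (λ k → ℤ.+ suc k) (trans (ℕ.*-identityʳ (n ℕ.* 1))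
       (trans (ℕ.*-identityʳ n) (sym (trans (ℕ.+-identityʳ (n ℕ.+ 0)) (ℕ.+-identityʳ n)))))) ⟩
    ℚᵘ.1ℚᵘ ∎)
  where open ℚᵘ.≃-Reasoning

-- Finite sums
Σ≤-cong : ∀ k {f g : ℕ → ℚ} → (∀ j → j ≤ k → f j ≡ g j) → Σ≤ k f ≡ Σ≤ k g
Σ≤-cong zero    f≡g = f≡g 0 z≤n
Σ≤-cong (suc k) f≡g =
  cong₂ _+_ (Σ≤-cong k (λ j j≤k → f≡g j (ℕ.m≤n⇒m≤1+n j≤k))) (f≡g (suc k) ℕ.≤-refl)

Σ≤-cong′ : ∀ k {f g : ℕ → ℚ} → (∀ j → f j ≡ g j) → Σ≤ k f ≡ Σ≤ k g
Σ≤-cong′ k f≡g = Σ≤-cong k (λ j _ → f≡g j)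

Σ<-cong : ∀ k {f g : ℕ → ℚ} → (∀ j → j < k → f j ≡ g j) → Σ< k f ≡ Σ< k g
Σ<-cong zero    f≡g = refl
Σ<-cong (suc k) f≡g =
  cong₂ _+_ (Σ<-cong k (λ j j<k → f≡g j (ℕ.m≤n⇒m≤1+n j<k))) (f≡g k ℕ.≤-refl)

Σ<-suc≡Σ≤ : ∀ m (f : ℕ → ℚ) → Σ< (suc m) f ≡ Σ≤ m f
Σ<-suc≡Σ≤ zero    f = ℚ.+-identityˡ (f 0)
Σ<-suc≡Σ≤ (suc m) f = cong (_+ f (suc m)) (Σ<-suc≡Σ≤ m f)

Σ≤-distrib-+ : ∀ k (f g : ℕ → ℚ) → Σ≤ k (λ j → f j + g j) ≡ Σ≤ k f + Σ≤ k g
Σ≤-distrib-+ zero    f g = refl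
Σ≤-distrib-+ (suc k) f g = trans (cong (_+ (f (suc k) + g (suc k))) (Σ≤-distrib-+ k f g))
  (solve 4 (λ a b c d → (a :+ b) :+ (c :+ d) := (a :+ c) :+ (b :+ d)) refl
    (Σ≤ k f) (Σ≤ k g) (f (suc k)) (g (suc k)))

*-distribˡ-Σ≤ : ∀ k c (f : ℕ → ℚ) → c * Σ≤ k f ≡ Σ≤ k (λ j → c * f j)
*-distribˡ-Σ≤ zero    c f = refl
*-distribˡ-Σ≤ (suc k) c f =
  trans (ℚ.*-distribˡ-+ c (Σ≤ k f) (f (suc k))) (cong (_+ c * f (suc k)) (*-distribˡ-Σ≤ k c f))

*-distribʳ-Σ≤ : ∀ k c (f : ℕ → ℚ) → Σ≤ k f * c ≡ Σ≤ k (λ j → f j * c)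
*-distribʳ-Σ≤ k c f = trans (ℚ.*-comm (Σ≤ k f) c)
  (trans (*-distribˡ-Σ≤ k c f) (Σ≤-cong′ k (λ j → ℚ.*-comm c (f j))))

Σ≤-linear : ∀ k (c f g h : ℕ → ℚ) → (∀ j → j ≤ k → f j ≡ g j + h j) →
  Σ≤ k (λ j → c j * f j) ≡ Σ≤ k (λ j → c j * g j) + Σ≤ k (λ j → c j * h j)
Σ≤-linear k c f g h f≡g+h = trans
  (Σ≤-cong k (λ j j≤k → trans (cong (c j *_) (f≡g+h j j≤k)) (ℚ.*-distribˡ-+ (c j) (g j) (h j))))
  (Σ≤-distrib-+ k _ _)

Σ≤-zero : ∀ k → Σ≤ k (λ _ → 0ℚ) ≡ 0ℚ
Σ≤-zero zero    = refl
Σ≤-zero (suc k) = cong (_+ 0ℚ) (Σ≤-zero k)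

Σ≤-unfoldˡ : ∀ k (f : ℕ → ℚ) → Σ≤ (suc k) f ≡ f 0 + Σ≤ k (λ j → f (suc j))
Σ≤-unfoldˡ zero    f = refl
Σ≤-unfoldˡ (suc k) f =
  trans (cong (_+ f (suc (suc k))) (Σ≤-unfoldˡ k f)) (ℚ.+-assoc (f 0) _ _)

Σ≤-reverse : ∀ k (f : ℕ → ℚ) → Σ≤ k f ≡ Σ≤ k (λ j → f (k ∸ j))
Σ≤-reverse zero    f = refl
Σ≤-reverse (suc k) f = trans (cong (_+ f (suc k)) (Σ≤-reverse k f))
  (trans (ℚ.+-comm _ (f (suc k))) (sym (Σ≤-unfoldˡ k (λ j → f (suc k ∸ j)))))

-- Both sides sum F over the triangle j + k ≤ q; each is rearranged into the sum over anti-diagonals.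
Σ≤-triangle-swap : ∀ q (F : ℕ → ℕ → ℚ) →
  Σ≤ q (λ j → Σ≤ (q ∸ j) (F j)) ≡ Σ≤ q (λ k → Σ≤ (q ∸ k) (λ j → F j k))
Σ≤-triangle-swap q F = begin
    Σ≤ q (λ j → Σ≤ (q ∸ j) (F j))
  ≡⟨ rows≡diagonals q F ⟩
    Σ≤ q (λ d → Σ≤ d (λ j → F j (d ∸ j)))
  ≡⟨ Σ≤-cong′ q (λ d → trans (Σ≤-reverse d _)
       (Σ≤-cong d (λ k k≤d → cong (F (d ∸ k)) (ℕ.m∸[m∸n]≡n k≤d)))) ⟩
    Σ≤ q (λ d → Σ≤ d (λ k → F (d ∸ k) k))
  ≡⟨ sym (rows≡diagonals q (λ k j → F j k)) ⟩
    Σ≤ q (λ k → Σ≤ (q ∸ k) (λ j → F j k)) ∎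
  where
  open ≡-Reasoning
  rows≡diagonals : ∀ q (G : ℕ → ℕ → ℚ) →
    Σ≤ q (λ j → Σ≤ (q ∸ j) (G j)) ≡ Σ≤ q (λ d → Σ≤ d (λ j → G j (d ∸ j)))
  rows≡diagonals zero    G = refl
  rows≡diagonals (suc q) G = begin
      Σ≤ q (λ j → Σ≤ (suc q ∸ j) (G j)) + Σ≤ (q ∸ q) (G (suc q))
    ≡⟨ cong₂ _+_ (Σ≤-cong q (λ j j≤q → cong (λ m → Σ≤ m (G j)) (ℕ.+-∸-assoc 1 j≤q)))
                 (trans (cong (λ m → Σ≤ m (G (suc q))) (ℕ.n∸n≡0 q))
                        (cong (G (suc q)) (sym (ℕ.n∸n≡0 q)))) ⟩
      Σ≤ q (λ j → Σ≤ (q ∸ j) (G j) + G j (suc (q ∸ j))) + G (suc q) (q ∸ q)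
    ≡⟨ cong (_+ G (suc q) (q ∸ q)) (trans (Σ≤-distrib-+ q _ _)
         (cong (λ s → Σ≤ q (λ j → Σ≤ (q ∸ j) (G j)) + s)
           (Σ≤-cong q (λ j j≤q → cong (G j) (sym (ℕ.+-∸-assoc 1 j≤q)))))) ⟩
      (Σ≤ q (λ j → Σ≤ (q ∸ j) (G j)) + Σ≤ q (λ j → G j (suc q ∸ j))) + G (suc q) (q ∸ q)
    ≡⟨ ℚ.+-assoc (Σ≤ q (λ j → Σ≤ (q ∸ j) (G j))) _ _ ⟩
      Σ≤ q (λ j → Σ≤ (q ∸ j) (G j)) + Σ≤ (suc q) (λ j → G j (suc q ∸ j))
    ≡⟨ cong (_+ Σ≤ (suc q) (λ j → G j (suc q ∸ j))) (rows≡diagonals q G) ⟩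
      Σ≤ (suc q) (λ d → Σ≤ d (λ j → G j (d ∸ j))) ∎

-- Binomial coefficients
nCk*k!*[n∸k]!≡n! : ∀ {n k} → k ≤ n → (n C k) ℕ.* (k ! ℕ.* (n ∸ k) !) ≡ n !
nCk*k!*[n∸k]!≡n! {n} {k} k≤n =
  trans (cong (ℕ._* (k ! ℕ.* (n ∸ k) !)) (ℕ.nCk≡n!/k![n-k]! k≤n)) (ℕ.m/n*n≡m (ℕ.k![n∸k]!∣n! k≤n))
  where instance _ = k ℕ.!* (n ∸ k) !≢0

nCj*[n∸j]Ck*multinomial≡n! : ∀ n j k → j ℕ.+ k ≤ n →
  (n C j) ℕ.* ((n ∸ j) C k) ℕ.* (j ! ℕ.* (k ! ℕ.* (n ∸ (j ℕ.+ k)) !)) ≡ n !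
nCj*[n∸j]Ck*multinomial≡n! n j k j+k≤n = begin
    (n C j) ℕ.* ((n ∸ j) C k) ℕ.* (j ! ℕ.* (k ! ℕ.* (n ∸ (j ℕ.+ k)) !))
  ≡⟨ interchange (n C j) ((n ∸ j) C k) (j !) (k !) ((n ∸ (j ℕ.+ k)) !) ⟩
    (n C j) ℕ.* (j ! ℕ.* (((n ∸ j) C k) ℕ.* (k ! ℕ.* (n ∸ (j ℕ.+ k)) !)))
  ≡⟨ cong (λ m → (n C j) ℕ.* (j ! ℕ.* (((n ∸ j) C k) ℕ.* (k ! ℕ.* m !)))) (sym (ℕ.∸-+-assoc n j k)) ⟩
    (n C j) ℕ.* (j ! ℕ.* (((n ∸ j) C k) ℕ.* (k ! ℕ.* (n ∸ j ∸ k) !)))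
  ≡⟨ cong (λ m → (n C j) ℕ.* (j ! ℕ.* m)) (nCk*k!*[n∸k]!≡n! k≤n∸j) ⟩
    (n C j) ℕ.* (j ! ℕ.* (n ∸ j) !)
  ≡⟨ nCk*k!*[n∸k]!≡n! (ℕ.m+n≤o⇒m≤o j j+k≤n) ⟩
    n ! ∎
  where
  open ≡-Reasoning
  interchange : ∀ a b c d e → a ℕ.* b ℕ.* (c ℕ.* (d ℕ.* e)) ≡ a ℕ.* (c ℕ.* (b ℕ.* (d ℕ.* e)))
  interchange = solve-∀
  k≤n∸j : k ≤ n ∸ j
  k≤n∸j = ℕ.m+n≤o⇒m≤o∸n k (subst (_≤ n) (ℕ.+-comm j k) j+k≤n)

nCj*[n∸j]Ck≡nCk*[n∸k]Cj : ∀ n j k → j ℕ.+ k ≤ n → (n C j) ℕ.* ((n ∸ j) C k) ≡ (n C k) ℕ.* ((n ∸ k) C j)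
nCj*[n∸j]Ck≡nCk*[n∸k]Cj n j k j+k≤n = ℕ.*-cancelʳ-≡ _ _ d (begin
    (n C j) ℕ.* ((n ∸ j) C k) ℕ.* d
  ≡⟨ nCj*[n∸j]Ck*multinomial≡n! n j k j+k≤n ⟩
    n !
  ≡⟨ sym (nCj*[n∸j]Ck*multinomial≡n! n k j (subst (_≤ n) (ℕ.+-comm j k) j+k≤n)) ⟩
    (n C k) ℕ.* ((n ∸ k) C j) ℕ.* (k ! ℕ.* (j ! ℕ.* (n ∸ (k ℕ.+ j)) !))
  ≡⟨ cong ((n C k) ℕ.* ((n ∸ k) C j) ℕ.*_) (trans
       (cong (λ m → k ! ℕ.* (j ! ℕ.* (n ∸ m) !)) (ℕ.+-comm k j))
       (swap-left (k !) (j !) ((n ∸ (j ℕ.+ k)) !))) ⟩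
    (n C k) ℕ.* ((n ∸ k) C j) ℕ.* d ∎)
  where
  open ≡-Reasoning
  d = j ! ℕ.* (k ! ℕ.* (n ∸ (j ℕ.+ k)) !)
  swap-left : ∀ a b c → a ℕ.* (b ℕ.* c) ≡ b ℕ.* (a ℕ.* c)
  swap-left = solve-∀
  instance
    _ : ℕ.NonZero d
    _ = ℕ.m*n≢0 (j !) _ {{j ℕ.!≢0}} {{k ℕ.!* (n ∸ (j ℕ.+ k)) !≢0}}

[1+q]Ck*[1+q∸k]≡[1+q]*qCk : ∀ q k → k ≤ q → (suc q C k) ℕ.* (suc q ∸ k) ≡ suc q ℕ.* (q C k)
[1+q]Ck*[1+q∸k]≡[1+q]*qCk q k k≤q = begin
    (suc q C k) ℕ.* (suc q ∸ k)
  ≡⟨ cong ((suc q C k) ℕ.*_) (sym (ℕ.nC1≡n (suc q ∸ k))) ⟩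
    (suc q C k) ℕ.* ((suc q ∸ k) C 1)
  ≡⟨ sym (nCj*[n∸j]Ck≡nCk*[n∸k]Cj (suc q) 1 k (ℕ.s≤s k≤q)) ⟩
    (suc q C 1) ℕ.* (q C k)
  ≡⟨ cong (ℕ._* (q C k)) (ℕ.nC1≡n (suc q)) ⟩
    suc q ℕ.* (q C k) ∎
  where open ≡-Reasoning

[1+n]Cn≡1+n : ∀ n → suc n C n ≡ suc n
[1+n]Cn≡1+n n = trans (ℕ.nCk≡nC[n∸k] (ℕ.n≤1+n n))
  (trans (cong (suc n C_) (trans (ℕ.+-∸-assoc 1 (ℕ.≤-refl {n})) (cong suc (ℕ.n∸n≡0 n))))
         (ℕ.nC1≡n (suc n)))

-- Bernoulli numbers
bernoulliStep : (ℕ → ℚ) → ℕ → ℚ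
bernoulliStep b m = 1ℚ - inv (suc m) * Σ< m (λ j → ι (suc m C j) * b j)

bernoulliFuel : ℕ → ℕ → ℚ
bernoulliFuel zero    _ = 1ℚ
bernoulliFuel (suc f)   = bernoulliStep (bernoulliFuel f)

bernoulliFuel-irrelevant : ∀ f g j → j ≤ f → j ≤ g → bernoulliFuel f j ≡ bernoulliFuel g j
bernoulliFuel-irrelevant zero    zero    j       _   _   = refl
bernoulliFuel-irrelevant zero    (suc g) zero    _   _   = refl
bernoulliFuel-irrelevant (suc f) zero    zero    _   _   = refl
bernoulliFuel-irrelevant (suc f) (suc g) j       j≤f j≤g =
  cong (λ s → 1ℚ - inv (suc j) * s) (Σ<-cong j (λ i i<j → cong (ι (suc j C i) *_)
    (bernoulliFuel-irrelevant f g i (ℕ.≤-pred (ℕ.<-≤-trans i<j j≤f)) (ℕ.≤-pred (ℕ.<-≤-trans i<j j≤g)))))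

bernoulliFuel-unique : {G : ℕ → ℕ → ℕ → ℚ} →
  (∀ p j → G p 0 j ≡ 1ℚ) → (∀ p f j → G p (suc f) j ≡ bernoulliStep (G p f) j) →
  ∀ p f j → G p f j ≡ bernoulliFuel f j
bernoulliFuel-unique G0 Gsuc p zero    j = G0 p j
bernoulliFuel-unique G0 Gsuc p (suc f) j = trans (Gsuc p f j)
  (cong (λ s → 1ℚ - inv (suc j) * s)
    (Σ<-cong j (λ i _ → cong (ι (suc j C i) *_) (bernoulliFuel-unique G0 Gsuc p f i))))

-- Defs computes B with a where-bound copy of bernoulliFuel (taking B's argument as an extra,
-- unused parameter).  That copy cannot be named here; it is extracted by unification below.
private
  B-suc-step : ∀ m → Σ (ℕ → ℚ) λ b → B (suc m) ≡ bernoulliStep b (suc m)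
  B-suc-step m = _ , refl

  B-suc-step-fuel : (t : ℕ × ℕ) →
    proj₁ (B-suc-step (proj₁ t)) (proj₂ t) ≡ bernoulliFuel (proj₁ t) (proj₂ t)
  B-suc-step-fuel t with suc (proj₁ t) | proj₁ t | proj₂ t | bernoulliFuel-unique {G = _}
  ... | p | f | j | unique = unique (λ _ _ → refl) (λ _ _ _ → refl) p f j

B≡bernoulliFuel : ∀ m → B m ≡ bernoulliFuel m m
B≡bernoulliFuel zero    = refl
B≡bernoulliFuel (suc m) = trans (proj₂ (B-suc-step m))
  (cong (λ s → 1ℚ - inv (suc (suc m)) * s)
    (Σ<-cong (suc m) (λ j _ → cong (ι (suc (suc m) C j) *_) (B-suc-step-fuel (m , j)))))

B-unfold : ∀ m → B m ≡ bernoulliStep B m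
B-unfold zero    = refl
B-unfold (suc m) = trans (B≡bernoulliFuel (suc m))
  (cong (λ s → 1ℚ - inv (suc (suc m)) * s)
    (Σ<-cong (suc m) (λ j j<1+m → cong (ι (suc (suc m) C j) *_)
      (trans (bernoulliFuel-irrelevant m j j (ℕ.≤-pred j<1+m) ℕ.≤-refl) (sym (B≡bernoulliFuel j))))))

Σ≤[1+mCj*Bj]≡1+m : ∀ m → Σ≤ m (λ j → ι (suc m C j) * B j) ≡ ι (suc m)
Σ≤[1+mCj*Bj]≡1+m m = begin
    Σ≤ m b
  ≡⟨ sym (Σ<-suc≡Σ≤ m b) ⟩
    Σ< m b + ι (suc m C m) * B m
  ≡⟨ cong₂ (λ c β → Σ< m b + ι c * β) ([1+n]Cn≡1+n m) (B-unfold m) ⟩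
    Σ< m b + ι (suc m) * (1ℚ - inv (suc m) * Σ< m b)
  ≡⟨ solve 3 (λ s N h → s :+ N :* (con 1ℚ :- h :* s) := N :+ s :* (con 1ℚ :- N :* h)) refl
       (Σ< m b) (ι (suc m)) (inv (suc m)) ⟩
    ι (suc m) + Σ< m b * (1ℚ - ι (suc m) * inv (suc m))
  ≡⟨ cong (λ x → ι (suc m) + Σ< m b * (1ℚ - x)) (ι*inv≡1 m) ⟩
    ι (suc m) + Σ< m b * (1ℚ - 1ℚ)
  ≡⟨ solve 2 (λ N s → N :+ s :* (con 1ℚ :- con 1ℚ) := N) refl (ι (suc m)) (Σ< m b) ⟩
    ι (suc m) ∎
  where
  open ≡-Reasoning
  b : ℕ → ℚ
  b j = ι (suc m C j) * B j

-- Faulhaber's formula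
pow-binomial : ∀ m x → pow (x + 1ℚ) m ≡ Σ≤ m (λ k → ι (m C k) * pow x k)
pow-binomial zero    x = refl
pow-binomial (suc m) x = begin
    pow (x + 1ℚ) m * (x + 1ℚ)
  ≡⟨ cong (_* (x + 1ℚ)) (pow-binomial m x) ⟩
    Σ≤ m (λ k → c k * pow x k) * (x + 1ℚ)
  ≡⟨ solve 2 (λ s x → s :* (x :+ con 1ℚ) := s :* x :+ s) refl (Σ≤ m (λ k → c k * pow x k)) x ⟩
    Σ≤ m (λ k → c k * pow x k) * x + Σ≤ m (λ k → c k * pow x k)
  ≡⟨ cong₂ _+_ (trans (*-distribʳ-Σ≤ m x _) (Σ≤-cong′ m (λ k → ℚ.*-assoc (c k) (pow x k) x)))
               (sym lower) ⟩
    Σ≤ m (λ k → c k * pow x (suc k)) + (1ℚ + Σ≤ m (λ k → c (suc k) * pow x (suc k)))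
  ≡⟨ solve 3 (λ s t u → s :+ (u :+ t) := u :+ (t :+ s)) refl
       (Σ≤ m (λ k → c k * pow x (suc k))) (Σ≤ m (λ k → c (suc k) * pow x (suc k))) 1ℚ ⟩
    1ℚ + (Σ≤ m (λ k → c (suc k) * pow x (suc k)) + Σ≤ m (λ k → c k * pow x (suc k)))
  ≡⟨ cong (1ℚ +_) (trans (sym (Σ≤-distrib-+ m _ _)) (Σ≤-cong′ m pascal)) ⟩
    1ℚ + Σ≤ m (λ k → ι (suc m C suc k) * pow x (suc k))
  ≡⟨ sym (Σ≤-unfoldˡ m (λ k → ι (suc m C k) * pow x k)) ⟩
    Σ≤ (suc m) (λ k → ι (suc m C k) * pow x k) ∎
  where
  open ≡-Reasoning
  c : ℕ → ℚ
  c k = ι (m C k)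
  pascal : ∀ k → c (suc k) * pow x (suc k) + c k * pow x (suc k) ≡ ι (suc m C suc k) * pow x (suc k)
  pascal k = trans (sym (ℚ.*-distribʳ-+ (pow x (suc k)) (c (suc k)) (c k)))
    (cong (_* pow x (suc k)) (trans (sym (ι-homo-+ (m C suc k) (m C k)))
      (cong ι (trans (ℕ.+-comm (m C suc k) (m C k)) (ℕ.nCk+nC[k+1]≡[n+1]C[k+1] m k)))))
  lower : 1ℚ + Σ≤ m (λ k → c (suc k) * pow x (suc k)) ≡ Σ≤ m (λ k → c k * pow x k)
  lower = begin
      1ℚ + Σ≤ m (λ k → c (suc k) * pow x (suc k))
    ≡⟨ sym (Σ≤-unfoldˡ m (λ k → c k * pow x k)) ⟩
      Σ≤ m (λ k → c k * pow x k) + c (suc m) * pow x (suc m)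
    ≡⟨ cong (λ n → Σ≤ m (λ k → c k * pow x k) + ι n * pow x (suc m)) (ℕ.k>n⇒nCk≡0 (ℕ.n<1+n m)) ⟩
      Σ≤ m (λ k → c k * pow x k) + 0ℚ * pow x (suc m)
    ≡⟨ trans (cong (Σ≤ m (λ k → c k * pow x k) +_) (ℚ.*-zeroˡ (pow x (suc m)))) (ℚ.+-identityʳ _) ⟩
      Σ≤ m (λ k → c k * pow x k) ∎

coeff : ℕ → ℕ → ℚ
coeff N j = ι (N C j) * B j * inv N

pow-binomial-top : ∀ {q j} x → j ≤ q →
  pow (x + 1ℚ) (suc q ∸ j) ≡ pow x (suc q ∸ j) + Σ≤ (q ∸ j) (λ k → ι ((suc q ∸ j) C k) * pow x k)
pow-binomial-top {q} {j} x j≤q rewrite ℕ.+-∸-assoc 1 j≤q = begin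
    pow (x + 1ℚ) (suc (q ∸ j))
  ≡⟨ pow-binomial (suc (q ∸ j)) x ⟩
    Σ≤ (q ∸ j) (λ k → ι (suc (q ∸ j) C k) * pow x k) + ι (suc (q ∸ j) C suc (q ∸ j)) * pow x (suc (q ∸ j))
  ≡⟨ cong (λ n → Σ≤ (q ∸ j) (λ k → ι (suc (q ∸ j) C k) * pow x k) + ι n * pow x (suc (q ∸ j)))
       (ℕ.nCn≡1 (suc (q ∸ j))) ⟩
    Σ≤ (q ∸ j) (λ k → ι (suc (q ∸ j) C k) * pow x k) + 1ℚ * pow x (suc (q ∸ j))
  ≡⟨ trans (ℚ.+-comm (Σ≤ (q ∸ j) (λ k → ι (suc (q ∸ j) C k) * pow x k)) _)
       (cong (_+ Σ≤ (q ∸ j) (λ k → ι (suc (q ∸ j) C k) * pow x k)) (ℚ.*-identityˡ (pow x (suc (q ∸ j))))) ⟩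
    pow x (suc (q ∸ j)) + Σ≤ (q ∸ j) (λ k → ι (suc (q ∸ j) C k) * pow x k) ∎
  where open ≡-Reasoning

-- The recurrence Σ≤[1+mCj*Bj]≡1+m, after C(q+1,j) C(q+1−j,k) = C(q+1,k) C(q+1−k,j).
Σ≤[coeff*binomial]≡binomial : ∀ q k → k ≤ q →
  Σ≤ (q ∸ k) (λ j → coeff (suc q) j * ι ((suc q ∸ j) C k)) ≡ ι (q C k)
Σ≤[coeff*binomial]≡binomial q k k≤q = begin
    Σ≤ (q ∸ k) (λ j → coeff (suc q) j * ι ((suc q ∸ j) C k))
  ≡⟨ Σ≤-cong (q ∸ k) regroup ⟩
    Σ≤ (q ∸ k) (λ j → c * (ι ((suc q ∸ k) C j) * B j))
  ≡⟨ sym (*-distribˡ-Σ≤ (q ∸ k) c _) ⟩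
    c * Σ≤ (q ∸ k) (λ j → ι ((suc q ∸ k) C j) * B j)
  ≡⟨ cong (λ n → c * Σ≤ (q ∸ k) (λ j → ι (n C j) * B j)) (ℕ.+-∸-assoc 1 k≤q) ⟩
    c * Σ≤ (q ∸ k) (λ j → ι (suc (q ∸ k) C j) * B j)
  ≡⟨ cong (c *_) (trans (Σ≤[1+mCj*Bj]≡1+m (q ∸ k)) (cong ι (sym (ℕ.+-∸-assoc 1 k≤q)))) ⟩
    ι (suc q C k) * inv (suc q) * ι (suc q ∸ k)
  ≡⟨ solve 3 (λ a h s → a :* h :* s := a :* s :* h) refl (ι (suc q C k)) (inv (suc q)) (ι (suc q ∸ k)) ⟩
    ι (suc q C k) * ι (suc q ∸ k) * inv (suc q)
  ≡⟨ cong (_* inv (suc q)) (trans (sym (ι-homo-* (suc q C k) (suc q ∸ k)))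
       (trans (cong ι ([1+q]Ck*[1+q∸k]≡[1+q]*qCk q k k≤q)) (ι-homo-* (suc q) (q C k)))) ⟩
    ι (suc q) * ι (q C k) * inv (suc q)
  ≡⟨ solve 3 (λ N a h → N :* a :* h := a :* (N :* h)) refl (ι (suc q)) (ι (q C k)) (inv (suc q)) ⟩
    ι (q C k) * (ι (suc q) * inv (suc q))
  ≡⟨ trans (cong (ι (q C k) *_) (ι*inv≡1 q)) (ℚ.*-identityʳ _) ⟩
    ι (q C k) ∎
  where
  open ≡-Reasoning
  c = ι (suc q C k) * inv (suc q)
  regroup : ∀ j → j ≤ q ∸ k → coeff (suc q) j * ι ((suc q ∸ j) C k) ≡ c * (ι ((suc q ∸ k) C j) * B j)
  regroup j j≤q∸k = begin
      ι (suc q C j) * B j * inv (suc q) * ι ((suc q ∸ j) C k)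
    ≡⟨ solve 4 (λ a b h a′ → a :* b :* h :* a′ := (a :* a′) :* (b :* h)) refl
         (ι (suc q C j)) (B j) (inv (suc q)) (ι ((suc q ∸ j) C k)) ⟩
      ι (suc q C j) * ι ((suc q ∸ j) C k) * (B j * inv (suc q))
    ≡⟨ cong (_* (B j * inv (suc q))) (trans (sym (ι-homo-* (suc q C j) ((suc q ∸ j) C k)))
         (trans (cong ι (nCj*[n∸j]Ck≡nCk*[n∸k]Cj (suc q) j k j+k≤1+q))
                (ι-homo-* (suc q C k) ((suc q ∸ k) C j)))) ⟩
      ι (suc q C k) * ι ((suc q ∸ k) C j) * (B j * inv (suc q))
    ≡⟨ solve 4 (λ a a′ b h → a :* a′ :* (b :* h) := a :* h :* (a′ :* b)) refl
         (ι (suc q C k)) (ι ((suc q ∸ k) C j)) (B j) (inv (suc q)) ⟩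
      c * (ι ((suc q ∸ k) C j) * B j) ∎
    where
    j+k≤1+q : j ℕ.+ k ≤ suc q
    j+k≤1+q = ℕ.m≤n⇒m≤1+n (subst (j ℕ.+ k ≤_) (ℕ.m∸n+n≡m k≤q) (ℕ.+-monoˡ-≤ k j≤q∸k))

Cp-shift : ∀ q x → Cp q [] (x + 1ℚ) ≡ Cp q [] x + pow (x + 1ℚ) q
Cp-shift q x = begin
    Σ≤ q (λ j → coeff (suc q) j * pow (x + 1ℚ) (suc q ∸ j))
  ≡⟨ Σ≤-linear q (coeff (suc q)) _ _ _ (λ j j≤q → pow-binomial-top x j≤q) ⟩
    Cp q [] x + Σ≤ q (λ j → coeff (suc q) j * Σ≤ (q ∸ j) (λ k → ι ((suc q ∸ j) C k) * pow x k))
  ≡⟨ cong (Cp q [] x +_) lower-terms ⟩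
    Cp q [] x + pow (x + 1ℚ) q ∎
  where
  open ≡-Reasoning
  lower-terms : Σ≤ q (λ j → coeff (suc q) j * Σ≤ (q ∸ j) (λ k → ι ((suc q ∸ j) C k) * pow x k))
                  ≡ pow (x + 1ℚ) q
  lower-terms = begin
      Σ≤ q (λ j → coeff (suc q) j * Σ≤ (q ∸ j) (λ k → ι ((suc q ∸ j) C k) * pow x k))
    ≡⟨ Σ≤-cong′ q (λ j → trans (*-distribˡ-Σ≤ (q ∸ j) (coeff (suc q) j) _)
         (Σ≤-cong′ (q ∸ j) (λ k → sym (ℚ.*-assoc (coeff (suc q) j) _ _)))) ⟩
      Σ≤ q (λ j → Σ≤ (q ∸ j) (λ k → coeff (suc q) j * ι ((suc q ∸ j) C k) * pow x k))
    ≡⟨ Σ≤-triangle-swap q (λ j k → coeff (suc q) j * ι ((suc q ∸ j) C k) * pow x k) ⟩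
      Σ≤ q (λ k → Σ≤ (q ∸ k) (λ j → coeff (suc q) j * ι ((suc q ∸ j) C k) * pow x k))
    ≡⟨ Σ≤-cong q (λ k k≤q → trans (sym (*-distribʳ-Σ≤ (q ∸ k) (pow x k) _))
         (cong (_* pow x k) (Σ≤[coeff*binomial]≡binomial q k k≤q))) ⟩
      Σ≤ q (λ k → ι (q C k) * pow x k)
    ≡⟨ sym (pow-binomial q x) ⟩
      pow (x + 1ℚ) q ∎

-- The polynomials C^(p)_0, C^(p)_{0,0} and C^(p)_1
Cp[]-tail : ∀ p J x → J ≤ p →
  Σ≤ (p ∸ J) (λ k → coeff (suc p ∸ J) k * pow x (suc p ∸ (J ℕ.+ k))) ≡ Cp (p ∸ J) [] x
Cp[]-tail p J x J≤p = Σ≤-cong′ (p ∸ J) (λ k →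
  cong₂ _*_ (cong (λ N → coeff N k) 1+p∸J≡1+[p∸J])
            (cong (pow x) (trans (sym (ℕ.∸-+-assoc (suc p) J k)) (cong (_∸ k) 1+p∸J≡1+[p∸J]))))
  where
  1+p∸J≡1+[p∸J] : suc p ∸ J ≡ suc (p ∸ J)
  1+p∸J≡1+[p∸J] = ℕ.+-∸-assoc 1 J≤p

Cp[0]≡Σ≤ : ∀ p x → Cp p (0 ∷ []) x ≡ Σ≤ p (λ j → coeff (suc p) j * Cp (p ∸ j) [] x)
Cp[0]≡Σ≤ p x = Σ≤-cong p (λ j j≤p → cong (coeff (suc p) j *_) (Cp[]-tail p j x j≤p))

Cp[0,0]≡Σ≤ : ∀ p x → Cp p (0 ∷ 0 ∷ []) x ≡ Σ≤ p (λ j → coeff (suc p) j * Cp (p ∸ j) (0 ∷ []) x)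
Cp[0,0]≡Σ≤ p x = Σ≤-cong p (λ j j≤p → cong (coeff (suc p) j *_) (trans
  (Σ≤-cong (p ∸ j) (λ k k≤p∸j → cong₂ _*_
    (cong (λ N → coeff N k) (ℕ.+-∸-assoc 1 j≤p))
    (trans (Cp[]-tail p (j ℕ.+ k) x (j+k≤p j≤p k≤p∸j)) (cong (λ m → Cp m [] x) (sym (ℕ.∸-+-assoc p j k))))))
  (sym (Cp[0]≡Σ≤ (p ∸ j) x))))
  where
  j+k≤p : ∀ {j k} → j ≤ p → k ≤ p ∸ j → j ℕ.+ k ≤ p
  j+k≤p {j} j≤p k≤p∸j = subst (j ℕ.+ _ ≤_) (ℕ.m+[n∸m]≡n j≤p) (ℕ.+-monoʳ-≤ j k≤p∸j)

Cp[1]≡Σ≤ : ∀ q x → Cp (suc q) (1 ∷ []) x ≡ Σ≤ q (λ j → coeff (suc (suc q)) j * Cp (q ∸ j) [] x)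
Cp[1]≡Σ≤ q x = Σ≤-cong q (λ j j≤q → cong (coeff (suc (suc q)) j *_) (Cp[]-tail q j x j≤q))

Σ≤-*-zero : ∀ k (c f : ℕ → ℚ) → (∀ j → j ≤ k → f j ≡ 0ℚ) → Σ≤ k (λ j → c j * f j) ≡ 0ℚ
Σ≤-*-zero k c f f≡0 =
  trans (Σ≤-cong k (λ j j≤k → trans (cong (c j *_) (f≡0 j j≤k)) (ℚ.*-zeroʳ (c j)))) (Σ≤-zero k)

Cp[]-at-0 : ∀ q → Cp q [] 0ℚ ≡ 0ℚ
Cp[]-at-0 q = Σ≤-*-zero q (coeff (suc q)) _ (λ j j≤q →
  trans (cong (pow 0ℚ) (ℕ.+-∸-assoc 1 j≤q)) (ℚ.*-zeroʳ (pow 0ℚ (q ∸ j))))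

Cp[0]-at-0 : ∀ p → Cp p (0 ∷ []) 0ℚ ≡ 0ℚ
Cp[0]-at-0 p = trans (Cp[0]≡Σ≤ p 0ℚ) (Σ≤-*-zero p (coeff (suc p)) _ (λ j _ → Cp[]-at-0 (p ∸ j)))

Cp[0,0]-at-0 : ∀ p → Cp p (0 ∷ 0 ∷ []) 0ℚ ≡ 0ℚ
Cp[0,0]-at-0 p = trans (Cp[0,0]≡Σ≤ p 0ℚ) (Σ≤-*-zero p (coeff (suc p)) _ (λ j _ → Cp[0]-at-0 (p ∸ j)))

Cp[1]-at-0 : ∀ p → Cp p (1 ∷ []) 0ℚ ≡ 0ℚ
Cp[1]-at-0 zero    = refl
Cp[1]-at-0 (suc q) = trans (Cp[1]≡Σ≤ q 0ℚ) (Σ≤-*-zero q (coeff (suc (suc q))) _ (λ j _ → Cp[]-at-0 (q ∸ j)))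

Cp[]≡Σ≤[coeff*pow]*x : ∀ q x → Cp q [] x ≡ Σ≤ q (λ j → coeff (suc q) j * pow x (q ∸ j)) * x
Cp[]≡Σ≤[coeff*pow]*x q x = trans
  (Σ≤-cong q (λ j j≤q → trans (cong (λ m → coeff (suc q) j * pow x m) (ℕ.+-∸-assoc 1 j≤q))
                              (sym (ℚ.*-assoc (coeff (suc q) j) (pow x (q ∸ j)) x))))
  (sym (*-distribʳ-Σ≤ q x _))

coeff[N,N∸1]≡B : ∀ q → coeff (suc (suc q)) (suc q) ≡ B (suc q)
coeff[N,N∸1]≡B q = begin
    ι (suc (suc q) C suc q) * B (suc q) * inv (suc (suc q))
  ≡⟨ cong (λ n → ι n * B (suc q) * inv (suc (suc q))) ([1+n]Cn≡1+n (suc q)) ⟩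
    ι (suc (suc q)) * B (suc q) * inv (suc (suc q))
  ≡⟨ solve 3 (λ N b h → N :* b :* h := b :* (N :* h)) refl (ι (suc (suc q))) (B (suc q)) (inv (suc (suc q))) ⟩
    B (suc q) * (ι (suc (suc q)) * inv (suc (suc q)))
  ≡⟨ trans (cong (B (suc q) *_) (ι*inv≡1 (suc q))) (ℚ.*-identityʳ (B (suc q))) ⟩
    B (suc q) ∎
  where open ≡-Reasoning

Cp[]≡Σ≤[coeff*pow]*x*x+B*x : ∀ q x →
  Cp (suc q) [] x ≡ Σ≤ q (λ j → coeff (suc (suc q)) j * pow x (q ∸ j)) * x * x + B (suc q) * x
Cp[]≡Σ≤[coeff*pow]*x*x+B*x q x = cong₂ _+_
  (trans (Σ≤-cong q (λ j j≤q → trans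
            (cong (λ m → coeff (suc (suc q)) j * pow x m) (ℕ.+-∸-assoc 2 j≤q))
            (solve 3 (λ c p x → c :* (p :* x :* x) := c :* p :* x :* x) refl (coeff (suc (suc q)) j) (pow x (q ∸ j)) x)))
    (trans (sym (*-distribʳ-Σ≤ q x _)) (cong (_* x) (sym (*-distribʳ-Σ≤ q x _)))))
  (cong₂ _*_ (coeff[N,N∸1]≡B q)
    (trans (cong (pow x) (trans (ℕ.+-∸-assoc 1 (ℕ.≤-refl {q})) (cong suc (ℕ.n∸n≡0 q)))) (ℚ.*-identityˡ x)))

-- Difference equations in n
Cp[]-succ : ∀ q n → Cp q [] (ι (suc n)) ≡ Cp q [] (ι n) + pow (ι (suc n)) q
Cp[]-succ q n rewrite ι-suc n = Cp-shift q (ι n)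

*-inverse-cancel : ∀ {z s y h} → y * h ≡ 1ℚ → s ≡ z * y → z ≡ s * h
*-inverse-cancel {z} {s} {y} {h} yh≡1 s≡zy = sym (begin
    s * h         ≡⟨ cong (_* h) s≡zy ⟩
    z * y * h     ≡⟨ ℚ.*-assoc z y h ⟩
    z * (y * h)   ≡⟨ cong (z *_) yh≡1 ⟩
    z * 1ℚ        ≡⟨ ℚ.*-identityʳ z ⟩
    z             ∎)
  where open ≡-Reasoning

Cp[0]-succ : ∀ p n →
  Cp p (0 ∷ []) (ι (suc n)) ≡ Cp p (0 ∷ []) (ι n) + Cp p [] (ι (suc n)) * inv (suc n)
Cp[0]-succ p n = begin
    Cp p (0 ∷ []) (ι (suc n))
  ≡⟨ Cp[0]≡Σ≤ p (ι (suc n)) ⟩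
    Σ≤ p (λ j → coeff (suc p) j * Cp (p ∸ j) [] (ι (suc n)))
  ≡⟨ Σ≤-linear p (coeff (suc p)) _ _ _ (λ j _ → Cp[]-succ (p ∸ j) n) ⟩
    Σ≤ p (λ j → coeff (suc p) j * Cp (p ∸ j) [] (ι n)) + Σ≤ p (λ j → coeff (suc p) j * pow (ι (suc n)) (p ∸ j))
  ≡⟨ cong₂ _+_ (sym (Cp[0]≡Σ≤ p (ι n)))
       (*-inverse-cancel (ι*inv≡1 n) (Cp[]≡Σ≤[coeff*pow]*x p (ι (suc n)))) ⟩
    Cp p (0 ∷ []) (ι n) + Cp p [] (ι (suc n)) * inv (suc n) ∎
  where open ≡-Reasoning

Cp[0,0]-succ : ∀ p n →
  Cp p (0 ∷ 0 ∷ []) (ι (suc n)) ≡ Cp p (0 ∷ 0 ∷ []) (ι n) + Cp p (0 ∷ []) (ι (suc n)) * inv (suc n)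
Cp[0,0]-succ p n = begin
    Cp p (0 ∷ 0 ∷ []) (ι (suc n))
  ≡⟨ Cp[0,0]≡Σ≤ p (ι (suc n)) ⟩
    Σ≤ p (λ j → coeff (suc p) j * Cp (p ∸ j) (0 ∷ []) (ι (suc n)))
  ≡⟨ Σ≤-linear p (coeff (suc p)) _ _ _ (λ j _ → Cp[0]-succ (p ∸ j) n) ⟩
    Σ≤ p (λ j → coeff (suc p) j * Cp (p ∸ j) (0 ∷ []) (ι n))
      + Σ≤ p (λ j → coeff (suc p) j * (Cp (p ∸ j) [] (ι (suc n)) * inv (suc n)))
  ≡⟨ cong₂ _+_ (sym (Cp[0,0]≡Σ≤ p (ι n)))
       (trans (Σ≤-cong′ p (λ j → sym (ℚ.*-assoc (coeff (suc p) j) _ (inv (suc n)))))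
       (trans (sym (*-distribʳ-Σ≤ p (inv (suc n)) _))
              (cong (_* inv (suc n)) (sym (Cp[0]≡Σ≤ p (ι (suc n))))))) ⟩
    Cp p (0 ∷ 0 ∷ []) (ι n) + Cp p (0 ∷ []) (ι (suc n)) * inv (suc n) ∎
  where open ≡-Reasoning

Cp[1]-succ : ∀ p n →
  Cp p (1 ∷ []) (ι (suc n))
    ≡ Cp p (1 ∷ []) (ι n) + Cp p [] (ι (suc n)) * inv (suc n) * inv (suc n) - B p * inv (suc n)
Cp[1]-succ zero    n = sym (begin
    0ℚ + coeff 1 0 * (1ℚ * y) * h * h - 1ℚ * h
  ≡⟨ solve 3 (λ c y h → con 0ℚ :+ c :* (con 1ℚ :* y) :* h :* h :- con 1ℚ :* h := c :* (y :* h) :* h :- h)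
       refl (coeff 1 0) y h ⟩
    coeff 1 0 * (y * h) * h - h
  ≡⟨ cong (λ z → coeff 1 0 * z * h - h) (ι*inv≡1 n) ⟩
    coeff 1 0 * 1ℚ * h - h
  ≡⟨ solve 1 (λ h → con 1ℚ :* con 1ℚ :* h :- h := con 0ℚ) refl h ⟩
    0ℚ ∎)
  where
  open ≡-Reasoning
  y = ι (suc n)
  h = inv (suc n)
Cp[1]-succ (suc q) n = begin
    Cp (suc q) (1 ∷ []) y
  ≡⟨ Cp[1]≡Σ≤ q y ⟩
    Σ≤ q (λ j → coeff (suc (suc q)) j * Cp (q ∸ j) [] y)
  ≡⟨ Σ≤-linear q (coeff (suc (suc q))) _ _ _ (λ j _ → Cp[]-succ (q ∸ j) n) ⟩
    Σ≤ q (λ j → coeff (suc (suc q)) j * Cp (q ∸ j) [] (ι n)) + w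
  ≡⟨ cong₂ _+_ (sym (Cp[1]≡Σ≤ q (ι n))) w≡Cp*h*h-B*h ⟩
    Cp (suc q) (1 ∷ []) (ι n) + (Cp (suc q) [] y * h * h - B (suc q) * h)
  ≡⟨ solve 3 (λ a s b → a :+ (s :- b) := a :+ s :- b) refl
       (Cp (suc q) (1 ∷ []) (ι n)) (Cp (suc q) [] y * h * h) (B (suc q) * h) ⟩
    Cp (suc q) (1 ∷ []) (ι n) + Cp (suc q) [] y * h * h - B (suc q) * h ∎
  where
  open ≡-Reasoning
  y = ι (suc n)
  h = inv (suc n)
  w = Σ≤ q (λ j → coeff (suc (suc q)) j * pow y (q ∸ j))
  w≡Cp*h*h-B*h : w ≡ Cp (suc q) [] y * h * h - B (suc q) * h
  w≡Cp*h*h-B*h = sym (begin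
      Cp (suc q) [] y * h * h - B (suc q) * h
    ≡⟨ cong (λ s → s * h * h - B (suc q) * h) (Cp[]≡Σ≤[coeff*pow]*x*x+B*x q y) ⟩
      (w * y * y + B (suc q) * y) * h * h - B (suc q) * h
    ≡⟨ solve 4 (λ w y h b → (w :* y :* y :+ b :* y) :* h :* h :- b :* h
                           := w :* (y :* h) :* (y :* h) :+ b :* (y :* h) :* h :- b :* h) refl w y h (B (suc q)) ⟩
      w * (y * h) * (y * h) + B (suc q) * (y * h) * h - B (suc q) * h
    ≡⟨ cong (λ e → w * e * e + B (suc q) * e * h - B (suc q) * h) (ι*inv≡1 n) ⟩
      w * 1ℚ * 1ℚ + B (suc q) * 1ℚ * h - B (suc q) * h
    ≡⟨ solve 3 (λ w b h → w :* con 1ℚ :* con 1ℚ :+ b :* con 1ℚ :* h :- b :* h := w) refl w (B (suc q)) h ⟩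
      w ∎)

closedForm : (b η s t u v : ℚ) → ℚ
closedForm b η s t u v = s * η * η - (ι 2 * t + b) * η + ι 2 * u - v

closedForm-step : ∀ {b η h s t u v P s′ t′ u′ v′} →
  s′ ≡ s + P → t′ ≡ t + s′ * h → u′ ≡ u + t′ * h → v′ ≡ v + s′ * h * h - b * h →
  closedForm b (η + h) s′ t′ u′ v′ ≡ closedForm b η s t u v + P * η * η
closedForm-step {b} {η} {h} {s} {t} {u} {v} {P} refl refl refl refl =
  solve 8 (λ b η h s t u v P →
    let s′ = s :+ P ; t′ = t :+ s′ :* h ; two = con 1ℚ :+ con 1ℚ in
    s′ :* (η :+ h) :* (η :+ h) :- (two :* t′ :+ b) :* (η :+ h) :+ two :* (u :+ t′ :* h)
      :- (v :+ s′ :* h :* h :- b :* h)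
    := s :* η :* η :- (two :* t :+ b) :* η :+ two :* u :- v :+ P :* η :* η)
    refl b η h s t u v P

closedForm-at-0 : ∀ b s t → closedForm b 0ℚ s t 0ℚ 0ℚ ≡ 0ℚ
closedForm-at-0 = solve 3 (λ b s t →
  s :* con 0ℚ :* con 0ℚ :- ((con 1ℚ :+ con 1ℚ) :* t :+ b) :* con 0ℚ :+ (con 1ℚ :+ con 1ℚ) :* con 0ℚ :- con 0ℚ
  := con 0ℚ) refl

harmonic-square-sum : ∀ p n →
  Σ< n (λ k → pow (ι (suc k)) p * H k * H k)
    ≡ closedForm (B p) (H n) (Cp p [] (ι n)) (Cp p (0 ∷ []) (ι n)) (Cp p (0 ∷ 0 ∷ []) (ι n)) (Cp p (1 ∷ []) (ι n))
harmonic-square-sum p zero = sym (trans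
  (cong₂ (closedForm (B p) 0ℚ (Cp p [] 0ℚ) (Cp p (0 ∷ []) 0ℚ)) (Cp[0,0]-at-0 p) (Cp[1]-at-0 p))
  (closedForm-at-0 (B p) (Cp p [] 0ℚ) (Cp p (0 ∷ []) 0ℚ)))
harmonic-square-sum p (suc n) = begin
    Σ< n (λ k → pow (ι (suc k)) p * H k * H k) + pow (ι (suc n)) p * H n * H n
  ≡⟨ cong (_+ pow (ι (suc n)) p * H n * H n) (harmonic-square-sum p n) ⟩
    closedForm (B p) (H n) (Cp p [] (ι n)) (Cp p (0 ∷ []) (ι n)) (Cp p (0 ∷ 0 ∷ []) (ι n)) (Cp p (1 ∷ []) (ι n))
      + pow (ι (suc n)) p * H n * H n
  ≡⟨ sym (closedForm-step {B p} {H n} {inv (suc n)}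
                           {Cp p [] (ι n)} {Cp p (0 ∷ []) (ι n)} {Cp p (0 ∷ 0 ∷ []) (ι n)} {Cp p (1 ∷ []) (ι n)}
           (Cp[]-succ p n) (Cp[0]-succ p n) (Cp[0,0]-succ p n) (Cp[1]-succ p n)) ⟩
    closedForm (B p) (H (suc n)) (Cp p [] (ι (suc n))) (Cp p (0 ∷ []) (ι (suc n)))
      (Cp p (0 ∷ 0 ∷ []) (ι (suc n))) (Cp p (1 ∷ []) (ι (suc n))) ∎
  where open ≡-Reasoning

theorem2p5 : (p n : ℕ) → 1 ≤ n →
    Σ< n (λ k → pow (ι (suc k)) p * H k * H k)
    ≡ Cp p [] (ι n) * H n * H n
    - (ι 2 * Cp p (0 ∷ []) (ι n) + B p) * H n
    + ι 2 * Cp p (0 ∷ 0 ∷ []) (ι n)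
    - Cp p (1 ∷ []) (ι n)
theorem2p5 p n _ = harmonic-square-sum p n
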